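{- Let $T \subseteq \omega^{<\omega}$ be a tree with no leaves, let $S \subseteq T$ be a subtree such that $0 \notin \mathrm{ran}(\eta)$ for all $\eta \in S$, let $S^+ = \{\eta^\frown \nu : \eta \in S, \nu \in \{0\}^{<\omega}\}$ and assume $S^+ \subseteq T$. Let $(p_\eta : \eta \in S)$ be a sequence of pairwise distinct primes, extended to $S^+$ by $p_{\eta^\frown \nu} = p_\eta$ for $\eta \in S$, $\nu \in \{0\}^{<\omega}$, and define $L(\eta) = \{p_\nu : \nu \in S^+ \text{ and } (\nu \triangleleft \eta \text{ or } \eta \trianglelefteq \nu)\}$ for $\eta \in T$. Let $G = G(T,L)$. If $S$ has an $\omega$-branch (i.e., there is $\eta \in \omega^\omega$ with $\eta\restriction n \in S$ for all $n$), then $G$ is not $\mathbb{Z}$-homogeneous (and so $G$ is not $\aleph_1$-free).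
   Context: Trees are nonempty subsets of $\omega^{<\omega}$ closed under initial segments; $\trianglelefteq$ is the initial segment relation and $\triangleleft$ proper initial segment. The group $G(T,L)$: for $n<\omega$ let $Q_n = \bigoplus_{\eta \in T\cap\omega^n} \mathbb{Q} x_\eta$ and let $G_n \le Q_n$ be the subgroup generated by $\{x_\eta : \eta \in T \cap \omega^n\} \cup \{\frac1p x_\eta : \eta \in T\cap \omega^n, p \in L(\eta)\}$; for $m \le n$ let $f_{(n,m)}: G_n \to G_m$ be the homomorphism determined by $x_\eta \mapsto x_{\eta\restriction m}$. Then $G(T,L) = \varprojlim (G_n, f_{(n,m)})$, a subgroup of $\prod_n G_n$ (an abelian non-Archimedean Polish group with the topology induced from the product of discrete groups). For a torsion-free abelian group, the type of an element is the equivalence class of its characteristic $(h_{p_i}(a))_{i}$ ($h_p(a) \in \omega\cup\{\infty\}$ the $p$-height), where characteristics are equivalent if they agree at all but finitely many coordinates and differ only at finite values; the group is $\mathbb{Z}$-homogeneous if every nonzero element has the type of $(0,0,\dots)$. It is $\aleph_1$-free if every countable subgroup is free abelian. -}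

module Defs where

open import Data.Nat as ℕ using (ℕ; zero; suc; _≤_; _^_)
open import Data.Nat.Primality using (Prime)
open import Data.Integer using (ℤ; +_)
open import Data.Rational as ℚ using (ℚ; 0ℚ)
open import Data.List using (List; []; _∷_; _++_; [_]; take; length; replicate; applyUpTo)
open import Data.List.Membership.Propositional using (_∈_)
open import Data.List.Properties using (≡-dec)
open import Data.Product using (Σ; ∃; ∃-syntax; _×_; _,_)
open import Data.Sum using (_⊎_)
open import Relation.Nullary using (¬_; yes; no)
open import Relation.Binary.PropositionalEquality using (_≡_; _≢_)

-- ω^{<ω} as List ℕ; subsets of ω^{<ω} as predicates.

Seq : Set
Seq = List ℕ

Subset : Set₁
Subset = Seq → Set

_⊴_ : Seq → Seq → Set
η ⊴ ν = ∃[ ρ ] (η ++ ρ ≡ ν)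

_◁_ : Seq → Seq → Set
η ◁ ν = (η ⊴ ν) × (η ≢ ν)

record IsTree (T : Subset) : Set where
  field
    nonempty : ∃[ η ] T η
    closed   : ∀ η ν → ν ⊴ η → T η → T ν

NoLeaves : Subset → Set
NoLeaves T = ∀ η → T η → ∃[ k ] T (η ++ [ k ])

_⊆_ : Subset → Subset → Set
A ⊆ B = ∀ η → A η → B η

Plus : Subset → Subset
Plus S ν = ∃[ η ] ∃[ j ] (S η × ν ≡ η ++ replicate j 0)

-- L(η) = { p_ν : ν ∈ S⁺, ν ◁ η or η ⊴ ν }, where p on S⁺ is the
-- extension p_{η⌢0^j} = p_η  (η ∈ S).  L(η) is a predicate on ℕ.
Lfun : Subset → (Seq → ℕ) → Seq → ℕ → Set
Lfun S p η q = ∃[ ν ] ∃[ ρ ] ∃[ j ]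
  (S ρ × ν ≡ ρ ++ replicate j 0 × q ≡ p ρ × (ν ◁ η ⊎ η ⊴ ν))

HasBranch : Subset → Set
HasBranch S = ∃[ b ] ∀ n → S (applyUpTo b n)

-- 1/d as a rational (d = 0 never occurs for the generators used: d is 1 or a prime)
frac : ℤ → ℕ → ℚ
frac z zero    = 0ℚ
frac z (suc d) = z ℚ./ suc d

-- A generator term  z · x_η  or  z · (1/p) x_η  (p ∈ L(η)),  η ∈ T ∩ ω^n, z ∈ ℤ.
record GenTerm (T : Subset) (L : Seq → ℕ → Set) (n : ℕ) : Set where
  field
    η     : Seq
    inT   : T η
    len   : length η ≡ n
    coef  : ℤ
    den   : ℕ
    denOK : den ≡ 1 ⊎ L η den

-- An element of G_n ≤ Q_n: a finite ℤ-combination of the generators.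
Elem : Subset → (Seq → ℕ → Set) → ℕ → Set
Elem T L n = List (GenTerm T L n)

termVal : ∀ {T L n} → GenTerm T L n → ℚ
termVal t = frac (GenTerm.coef t) (GenTerm.den t)

-- coefficient of x_ν in f_{(n,m)}(a) ∈ Q_m, where f_{(n,m)}: x_η ↦ x_{η↾m}
projCoeff : ∀ {T L n} → ℕ → Elem T L n → Seq → ℚ
projCoeff m [] ν = 0ℚ
projCoeff m (t ∷ ts) ν with ≡-dec ℕ._≟_ (take m (GenTerm.η t)) ν
... | yes _ = termVal t ℚ.+ projCoeff m ts ν
... | no  _ = projCoeff m ts ν

coeff : ∀ {T L n} → Elem T L n → Seq → ℚ
coeff {n = n} a ν = projCoeff n a ν

-- elements of G(T,L) = lim← (G_n, f_{(n,m)})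
record GElt (T : Subset) (L : Seq → ℕ → Set) : Set where
  field
    comp   : (n : ℕ) → Elem T L n
    compat : ∀ m n → m ≤ n → ∀ ν → projCoeff m (comp n) ν ≡ coeff (comp m) ν
open GElt public

IsZero : ∀ {T L} → GElt T L → Set
IsZero a = ∀ n ν → coeff (comp a n) ν ≡ 0ℚ

Divisible : ∀ {T L} → ℕ → ℕ → GElt T L → Set
Divisible {T} {L} p k a = Σ (GElt T L) λ b →
  ∀ n ν → (+ (p ^ k) ℚ./ 1) ℚ.* coeff (comp b n) ν ≡ coeff (comp a n) ν

HeightZero : ∀ {T L} → ℕ → GElt T L → Set
HeightZero p a = ¬ Divisible p 1 a

HeightFinite : ∀ {T L} → ℕ → GElt T L → Set
HeightFinite p a = ∃[ k ] ¬ Divisible p k a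

-- the characteristic (h_p(a))_p is equivalent to (0,0,...):
-- all heights finite, and h_p(a) = 0 for all but finitely many primes p
HasTypeZero : ∀ {T L} → GElt T L → Set
HasTypeZero a = (∀ p → Prime p → HeightFinite p a)
              × ∃[ N ] (∀ p → Prime p → N ≤ p → HeightZero p a)

ZHomogeneous : Subset → (Seq → ℕ → Set) → Set
ZHomogeneous T L = ∀ (a : GElt T L) → ¬ IsZero a → HasTypeZero a

-- Along an ω-branch b of S the elements x_{b↾n} are compatible, so
-- a = (x_{b↾n})_n is a nonzero element of G.  Every prime p_{b↾k} lies in
-- L(b↾n) for every n (b↾k and b↾n are comparable), hence
-- (x_{b↾n} / p_{b↾k})_n ∈ G and a is p_{b↾k}-divisible.  The primes p_{b↾k}
-- are pairwise distinct, so h_p(a) > 0 for infinitely many p, and a does not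
-- have the type of (0,0,…).
module Submission where

open import Defs
open import Data.Nat as ℕ using (ℕ; zero; suc; _≤_; _<_; s≤s; NonZero)
import Data.Nat.Properties as ℕ
open import Data.Nat.Coprimality using (1-coprimeTo) renaming (sym to coprime-sym)
open import Data.Nat.Primality using (Prime; prime⇒nonZero)
open import Data.Integer using (+_)
open import Data.Rational as ℚ using (ℚ; 0ℚ; 1ℚ; mkℚ)
import Data.Rational.Properties as ℚ
open import Data.List using ([]; _∷_; take; drop; length; applyUpTo)
open import Data.List.Membership.Propositional using (_∉_)
open import Data.List.Properties using (≡-dec; length-applyUpTo; take++drop≡id; ++-identityʳ)
open import Data.Product using (_,_)
open import Data.Sum using (_⊎_; inj₁; inj₂)
open import Data.Empty using (⊥-elim)
import Data.Fin as Fin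
import Data.Fin.Properties as Fin
open import Function using (_∘_)
open import Relation.Nullary using (¬_; yes; no)
open import Relation.Binary.PropositionalEquality
  using (_≡_; _≢_; refl; sym; trans; cong; cong₂; subst; module ≡-Reasoning)

*-frac-inverse : ∀ n .{{_ : NonZero n}} → (+ n ℚ./ 1) ℚ.* frac (+ 1) n ≡ 1ℚ
*-frac-inverse (suc d) = begin
  (+ suc d ℚ./ 1) ℚ.* (+ 1 ℚ./ suc d)
    ≡⟨ cong₂ ℚ._*_ (ℚ.normalize-coprime (coprime-sym (1-coprimeTo (suc d))))
                   (ℚ.normalize-coprime (1-coprimeTo (suc d))) ⟩
  n ℚ.* ℚ.1/ n
    ≡⟨ ℚ.*-inverseʳ n ⟩
  1ℚ ∎
  where
  open ≡-Reasoning
  n : ℚ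
  n = mkℚ (+ suc d) 0 (coprime-sym (1-coprimeTo (suc d)))

injective⇒unbounded : (f : ℕ → ℕ) → (∀ i j → i ≢ j → f i ≢ f j) → ∀ N → ¬ (∀ k → f k < N)
injective⇒unbounded f f-inj N f<N
  with Fin.pigeonhole (ℕ.n<1+n N) (λ i → Fin.fromℕ< (f<N (Fin.toℕ i)))
... | i , j , i<j , same-hole = f-inj (Fin.toℕ i) (Fin.toℕ j) (ℕ.<⇒≢ i<j)
  (trans (sym (Fin.toℕ-fromℕ< _)) (trans (cong Fin.toℕ same-hole) (Fin.toℕ-fromℕ< _)))

take-⊴ : ∀ m (η : Seq) → take m η ⊴ η
take-⊴ m η = drop m η , take++drop≡id m η

take-applyUpTo : ∀ (f : ℕ → ℕ) {m n} → m ≤ n → take m (applyUpTo f n) ≡ applyUpTo f m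
take-applyUpTo f {zero}  _         = refl
take-applyUpTo f {suc m} (s≤s m≤n) = cong (f 0 ∷_) (take-applyUpTo (f ∘ suc) m≤n)

applyUpTo-⊴ : ∀ (f : ℕ → ℕ) {m n} → m ≤ n → applyUpTo f m ⊴ applyUpTo f n
applyUpTo-⊴ f {m} {n} m≤n = subst (_⊴ applyUpTo f n) (take-applyUpTo f m≤n) (take-⊴ m (applyUpTo f n))

applyUpTo-injective : ∀ (f : ℕ → ℕ) {m n} → applyUpTo f m ≡ applyUpTo f n → m ≡ n
applyUpTo-injective f {m} {n} eq =
  trans (sym (length-applyUpTo f m)) (trans (cong length eq) (length-applyUpTo f n))

applyUpTo-comparable : ∀ (f : ℕ → ℕ) m n →
  applyUpTo f m ◁ applyUpTo f n ⊎ applyUpTo f n ⊴ applyUpTo f m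
applyUpTo-comparable f m n with m ℕ.<? n
... | yes m<n = inj₁ (applyUpTo-⊴ f (ℕ.<⇒≤ m<n) , ℕ.<⇒≢ m<n ∘ applyUpTo-injective f)
... | no  m≮n = inj₂ (applyUpTo-⊴ f (ℕ.≮⇒≥ m≮n))

comparable⇒∈Lfun : ∀ {S : Subset} {p : Seq → ℕ} {ρ η} →
  S ρ → ρ ◁ η ⊎ η ⊴ ρ → Lfun S p η (p ρ)
comparable⇒∈Lfun {ρ = ρ} ρ∈S ρ~η = ρ , ρ , 0 , ρ∈S , sym (++-identityʳ ρ) , refl , ρ~η

projCoeff-singleton-cong : ∀ {T L n n′} (t : GenTerm T L n) (t′ : GenTerm T L n′) m ν →
  take m (GenTerm.η t) ≡ take m (GenTerm.η t′) → termVal t ≡ termVal t′ →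
  projCoeff m (t ∷ []) ν ≡ projCoeff m (t′ ∷ []) ν
projCoeff-singleton-cong t t′ m ν same-η same-val
  with ≡-dec ℕ._≟_ (take m (GenTerm.η t)) ν | ≡-dec ℕ._≟_ (take m (GenTerm.η t′)) ν
... | yes _   | yes _   = cong (ℚ._+ 0ℚ) same-val
... | no  _   | no  _   = refl
... | yes t≡ν | no  t′≢ν = ⊥-elim (t′≢ν (trans (sym same-η) t≡ν))
... | no  t≢ν | yes t′≡ν = ⊥-elim (t≢ν (trans same-η t′≡ν))

divisibleByInfinitelyManyPrimes⇒¬HasTypeZero : ∀ {T L} {a : GElt T L} (q : ℕ → ℕ) →
  (∀ k → Prime (q k)) → (∀ i j → i ≢ j → q i ≢ q j) → (∀ k → Divisible (q k) 1 a) →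
  ¬ HasTypeZero a
divisibleByInfinitelyManyPrimes⇒¬HasTypeZero q prime q-inj divisible (_ , N , heightZero) =
  injective⇒unbounded q q-inj N
    (λ k → ℕ.≰⇒> (λ N≤qk → heightZero (q k) (prime k) N≤qk (divisible k)))

module BranchElement {T : Subset} {L : Seq → ℕ → Set}
                     (b : ℕ → ℕ) (b∈T : ∀ n → T (applyUpTo b n)) where

  branchTerm : (d : ℕ) → (∀ n → d ≡ 1 ⊎ L (applyUpTo b n) d) → ∀ n → GenTerm T L n
  branchTerm d d-ok n = record
    { η = applyUpTo b n ; inT = b∈T n ; len = length-applyUpTo b n
    ; coef = + 1 ; den = d ; denOK = d-ok n }

  branchElt : (d : ℕ) → (∀ n → d ≡ 1 ⊎ L (applyUpTo b n) d) → GElt T L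
  branchElt d d-ok = record
    { comp   = λ n → branchTerm d d-ok n ∷ []
    ; compat = λ m n m≤n ν → projCoeff-singleton-cong (branchTerm d d-ok n) (branchTerm d d-ok m) m ν
        (trans (take-applyUpTo b m≤n) (sym (take-applyUpTo b ℕ.≤-refl))) refl
    }

  branch : GElt T L
  branch = branchElt 1 (λ _ → inj₁ refl)

  branch-nonzero : ¬ IsZero branch
  branch-nonzero zero-everywhere with zero-everywhere 0 []
  ... | ()

  branch-divisible : ∀ q .{{_ : NonZero q}} → (∀ n → L (applyUpTo b n) q) → Divisible q 1 branch
  branch-divisible q q∈L = branchElt q (inj₂ ∘ q∈L) , q·branch/q≡branch
    where
    q·branch/q≡branch : ∀ n ν →
      (+ (q ℕ.^ 1) ℚ./ 1) ℚ.* coeff (comp (branchElt q (inj₂ ∘ q∈L)) n) ν ≡ coeff (comp branch n) ν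
    q·branch/q≡branch n ν with ≡-dec ℕ._≟_ (take n (applyUpTo b n)) ν
    ... | no  _ = ℚ.*-zeroʳ (+ (q ℕ.^ 1) ℚ./ 1)
    ... | yes _ = begin
      (+ (q ℕ.^ 1) ℚ./ 1) ℚ.* (frac (+ 1) q ℚ.+ 0ℚ)
        ≡⟨ cong₂ (λ k r → (+ k ℚ./ 1) ℚ.* r) (ℕ.*-identityʳ q) (ℚ.+-identityʳ _) ⟩
      (+ q ℚ./ 1) ℚ.* frac (+ 1) q
        ≡⟨ *-frac-inverse q ⟩
      1ℚ
        ≡⟨ sym (ℚ.+-identityʳ 1ℚ) ⟩
      frac (+ 1) 1 ℚ.+ 0ℚ ∎
      where open ≡-Reasoning

claim3p13 : (T S : Subset) (p : Seq → ℕ)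
    → IsTree T → NoLeaves T
    → IsTree S → S ⊆ T
    → (∀ η → S η → 0 ∉ η)
    → Plus S ⊆ T
    → (∀ η → S η → Prime (p η))
    → (∀ η η′ → S η → S η′ → η ≢ η′ → p η ≢ p η′)
    → HasBranch S
    → ¬ ZHomogeneous T (Lfun S p)
claim3p13 T S p _ _ _ S⊆T _ _ prime distinct (b , b∈S) homogeneous =
  divisibleByInfinitelyManyPrimes⇒¬HasTypeZero {a = branch} q q-prime q-injective q-divides
    (homogeneous branch branch-nonzero)
  where
  open BranchElement {T} {Lfun S p} b (λ n → S⊆T _ (b∈S n))

  q : ℕ → ℕ
  q k = p (applyUpTo b k)

  q-prime : ∀ k → Prime (q k)
  q-prime k = prime _ (b∈S k)

  q-injective : ∀ i j → i ≢ j → q i ≢ q j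
  q-injective i j i≢j = distinct _ _ (b∈S i) (b∈S j) (i≢j ∘ applyUpTo-injective b)

  q-divides : ∀ k → Divisible (q k) 1 branch
  q-divides k = branch-divisible (q k) {{prime⇒nonZero (q-prime k)}}
    (λ n → comparable⇒∈Lfun (b∈S k) (applyUpTo-comparable b k n))
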